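{- Let $G=(V,E)$ be a graph and $\sigma_i=(v_1,\dots,v_i)$ a sequence of $i$ distinct vertices of $V$. Suppose $H$ is an inclusion-wise maximal interval-order subgraph of $G$ with $H=G^\sigma$ for some ordering $\sigma$ of $V$ having prefix $\sigma_i$. Then: (i) if $u,v\in V\setminus\{v_1,\dots,v_i\}$ satisfy $N(u)\supseteq N(v)\cap N^+(v_i)$, then there exists an ordering $\sigma$ of $V$ with prefix $\sigma_i$ such that $G^\sigma=H$ and $u$ precedes $v$ in $\sigma$; (ii) in every ordering $\sigma$ of $V$ with prefix $\sigma_i$ and $G^\sigma=H$, $\sigma_i$ is immediately followed by all vertices of $N_i:=\{v\in V\setminus\{v_1,\dots,v_i\}: N(v)\supseteq N^+(v_i)\}$, in some order; (iii) if $|N^+(v_i)|=2$, then there are only two possibilities for $H$ (i.e. at most two maximal interval-order subgraphs of $G$ arise as $G^\sigma$ for orderings $\sigma$ with prefix $\sigma_i$).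
   Context: Graphs are simple; $N(v)$ is the neighbourhood of $v$ in $G$. An interval-order graph is the complement of an interval graph (intersection graph of closed real intervals); an interval-order subgraph of $G$ is a graph $(V,E')$, $E'\subseteq E$, that is an interval-order graph, maximal w.r.t. inclusion of edge sets. For an ordering $\sigma=(v_1,\dots,v_n)$ of $V$, set $V_0:=V$, $V_j:=V_{j-1}\cap N(v_j)$, let $E_j$ be the edges from $v_j$ to $V_j$, and $G^\sigma:=(V,E_1\cup\cdots\cup E_{n-1})$. For a prefix $\sigma_i=(v_1,\dots,v_i)$, $N^+(v_i):=V_i=N(v_1)\cap\cdots\cap N(v_i)$, which depends only on $\sigma_i$. -}

module Defs where

open import Level using (Level)
open import Data.Nat using (ℕ; _≤_; _<_)
open import Data.Fin using (Fin; toℕ)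
open import Data.Fin.Permutation using (Permutation′; _⟨$⟩ʳ_; _⟨$⟩ˡ_)
open import Data.Rational using (ℚ) renaming (_≤_ to _≤ℚ_; _<_ to _<ℚ_)
open import Data.Product using (Σ; ∃; _×_)
open import Data.Sum using (_⊎_)
open import Relation.Nullary using (¬_; Dec)
open import Relation.Binary.PropositionalEquality using (_≡_; _≢_)

record Graph (n : ℕ) : Set₁ where
  field
    Adj    : Fin n → Fin n → Set
    adj?   : ∀ x y → Dec (Adj x y)
    sym    : ∀ {x y} → Adj x y → Adj y x
    irrefl : ∀ {x} → ¬ Adj x x
open Graph public

EdgeRel : ℕ → Set₁
EdgeRel n = Fin n → Fin n → Set

_≅E_ : ∀ {n} → EdgeRel n → EdgeRel n → Set
_≅E_ {n} H K = ∀ (x y : Fin n) → (H x y → K x y) × (K x y → H x y)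

_⊆E_ : ∀ {n} → EdgeRel n → EdgeRel n → Set
_⊆E_ {n} H K = ∀ (x y : Fin n) → H x y → K x y

-- Interval-order graph: complement of the intersection graph of closed
-- (nonempty) intervals [l x , r x]; x y adjacent iff the intervals are disjoint.
IsIntervalOrderGraph : ∀ {n} → EdgeRel n → Set
IsIntervalOrderGraph {n} H =
  Σ (Fin n → ℚ) λ l → Σ (Fin n → ℚ) λ r →
    (∀ x → l x ≤ℚ r x) ×
    (∀ x y → (H x y → (r x <ℚ l y ⊎ r y <ℚ l x)) × ((r x <ℚ l y ⊎ r y <ℚ l x) → H x y))

IsIntervalOrderSubgraph : ∀ {n} → Graph n → EdgeRel n → Set₁
IsIntervalOrderSubgraph {n} G H =
  IsIntervalOrderGraph H × (H ⊆E Adj G) ×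
  (∀ (H' : EdgeRel n) → IsIntervalOrderGraph H' → H' ⊆E Adj G → H ⊆E H' → H' ⊆E H)

-- An ordering σ of V: position j (0-based) holds vertex σ ⟨$⟩ʳ j.
Ordering : ℕ → Set
Ordering n = Permutation′ n

-- G^σ: x y is an edge iff for some position j, x = v_j and y ∈ V_j
-- (y adjacent to all of v_1..v_j), or symmetrically.
GSigma : ∀ {n} → Graph n → Ordering n → EdgeRel n
GSigma {n} G σ x y =
  (∃ λ (j : Fin n) → (σ ⟨$⟩ʳ j ≡ x) × (∀ (k : Fin n) → toℕ k ≤ toℕ j → Adj G (σ ⟨$⟩ʳ k) y))
  ⊎
  (∃ λ (j : Fin n) → (σ ⟨$⟩ʳ j ≡ y) × (∀ (k : Fin n) → toℕ k ≤ toℕ j → Adj G (σ ⟨$⟩ʳ k) x))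

HasPrefix : ∀ {n i} → Ordering n → (Fin i → Fin n) → Set
HasPrefix {n} {i} σ τ = ∀ (k : Fin i) → ∃ λ (j : Fin n) → (toℕ j ≡ toℕ k) × (σ ⟨$⟩ʳ j ≡ τ k)

InPrefix : ∀ {n i} → (Fin i → Fin n) → Fin n → Set
InPrefix {i = i} τ w = ∃ λ (k : Fin i) → τ k ≡ w

-- w ∈ N⁺(v_i) = N(v_1) ∩ … ∩ N(v_i).
NPlus : ∀ {n i} → Graph n → (Fin i → Fin n) → Fin n → Set
NPlus {i = i} G τ w = ∀ (k : Fin i) → Adj G (τ k) w

Precedes : ∀ {n} → Ordering n → Fin n → Fin n → Set
Precedes σ u v = toℕ (σ ⟨$⟩ˡ u) < toℕ (σ ⟨$⟩ˡ v)

InNi : ∀ {n i} → Graph n → (Fin i → Fin n) → Fin n → Set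
InNi {n} G τ w = (¬ InPrefix τ w) × (∀ (x : Fin n) → NPlus G τ x → Adj G w x)

-- G^σ is an interval-order graph: the interval of x runs from the first position of σ holding a
-- non-neighbour of x to the position of x. If the entry at position j + 1 is adjacent to all of
-- V_j, swapping positions j and j + 1 only adds edges to G^σ, so by maximality G^σ = H is kept.
-- Iterating, a vertex adjacent to all of V_q can be moved forward to position q, where it is
-- joined to V_q; since G^σ cannot grow, those edges were already in H. This gives (i) at once.
-- For (ii), a vertex w of N_i moved right behind the prefix is joined to all of N⁺(v_i), so these
-- are arcs out of w in σ itself, and every vertex before w lies in N_i. For (iii), with
-- N⁺(v_i) = {a, b}, all arcs leaving the prefix and N_i go to the one of a, b that the first
-- vertex outside the prefix and N_i is adjacent to (if it is adjacent to one), so G^σ is fixed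
-- by that choice.
{-# OPTIONS --safe #-}
module Submission where

open import Defs
open import Data.Nat using (ℕ; zero; suc; s≤s; _≤_; _<_; _+_)
open import Data.Nat.Properties
  using (≤-refl; ≤-trans; ≤-<-trans; <-≤-trans; <⇒≤; ≮⇒≥; ≰⇒>; ≤∧≢⇒<; ≤-pred; n≤1+n; <-cmp; <⇒≢; m≤m+n; +-suc; +-identityʳ; m+[n∸m]≡n)
open import Data.Fin using (Fin; toℕ; fromℕ<; inject)
open import Data.Fin.Properties
  using (toℕ-injective; toℕ-fromℕ<; toℕ-inject; toℕ<n; _≟_; any?; all?; ¬∀⟶∃¬-smallest)
import Data.Fin.Permutation.Components as PC
open import Data.Fin.Permutation using (Permutation′; _⟨$⟩ʳ_; _⟨$⟩ˡ_; inverseˡ; inverseʳ; transpose; _∘ₚ_)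
import Data.Integer as ℤ
import Data.Integer.Properties as ℤ
open import Data.Rational using (ℚ; mkℚ) renaming (_≤_ to _≤ℚ_; _<_ to _<ℚ_)
open import Data.Rational.Base using (*≤*; *<*)
open import Data.Rational.Properties using (drop-*<*)
open import Data.Nat.Coprimality using (1-coprimeTo) renaming (sym to coprime-sym)
open import Data.Product using (Σ; ∃; _×_; _,_; proj₁; proj₂)
open import Data.Sum using (_⊎_; inj₁; inj₂; [_,_]′) renaming (map to ⊎-map; swap to ⊎-swap)
open import Data.Sum.Function.Propositional using (_⊎-⇔_)
open import Data.Empty using (⊥-elim)
open import Function using (_∘_; id)
open import Function.Bundles using (Inverse; _⇔_; mk⇔; module Equivalence)
open import Function.Definitions using (Injective)
open import Relation.Binary using (tri<; tri≈; tri>)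
open import Relation.Nullary using (¬_; yes; no; ¬?)
open import Relation.Nullary.Decidable using (decidable-stable; _×-dec_; _→-dec_)
open import Relation.Unary using (Decidable)
open import Relation.Binary.PropositionalEquality using (_≡_; _≢_; refl; trans; cong; subst; subst₂) renaming (sym to ≡-sym)

AllUpTo : ∀ {m} → (Fin m → Set) → Fin m → Set
AllUpTo P j = ∀ k → toℕ k ≤ toℕ j → P k

AllUpTo-≤ : ∀ {m} {P : Fin m → Set} {j j′ : Fin m} → toℕ j ≤ toℕ j′ → AllUpTo P j′ → AllUpTo P j
AllUpTo-≤ j≤j′ h k k≤j = h k (≤-trans k≤j j≤j′)

smallestCounterexample : ∀ {m} {P : Fin m → Set} → Decidable P → ¬ (∀ k → P k) →
  ∃ λ q → ¬ P q × (∀ k → toℕ k < toℕ q → P k)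
smallestCounterexample {m} {P} P? ¬∀P with ¬∀⟶∃¬-smallest m P P? ¬∀P
... | q , ¬Pq , below = q , ¬Pq , λ k k<q → subst P (inject-fromℕ< k<q) (below (fromℕ< k<q))
  where
  inject-fromℕ< : ∀ {k} (k<q : toℕ k < toℕ q) → inject (fromℕ< k<q) ≡ k
  inject-fromℕ< k<q = toℕ-injective (trans (toℕ-inject _) (toℕ-fromℕ< k<q))

none⊎first : ∀ {m} {P : Fin m → Set} → Decidable P →
  (∀ k → ¬ P k) ⊎ (∃ λ q → P q × (∀ k → toℕ k < toℕ q → ¬ P k))
none⊎first P? with all? (¬? ∘ P?)
... | yes none = inj₁ none
... | no some with smallestCounterexample (¬? ∘ P?) some
...   | q , ¬¬Pq , below = inj₂ (q , decidable-stable (P? q) ¬¬Pq , below)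

transpose-≡ˡ : ∀ {m} (a b : Fin m) → PC.transpose a b a ≡ b
transpose-≡ˡ a b with a ≟ a
... | yes _ = refl
... | no a≢a = ⊥-elim (a≢a refl)

transpose-≢ : ∀ {m} {a b k : Fin m} → k ≢ a → k ≢ b → PC.transpose a b k ≡ k
transpose-≢ {a = a} {b} {k} k≢a k≢b with k ≟ a
... | yes k≡a = ⊥-elim (k≢a k≡a)
... | no _ with k ≟ b
...   | yes k≡b = ⊥-elim (k≢b k≡b)
...   | no _ = refl

data TransposeView {m} (a b k : Fin m) : Fin m → Set where
  at-a  : k ≡ a → TransposeView a b k b
  at-b  : k ≢ a → k ≡ b → TransposeView a b k a
  other : k ≢ a → k ≢ b → TransposeView a b k k

transpose-view : ∀ {m} (a b k : Fin m) → TransposeView a b k (PC.transpose a b k)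
transpose-view a b k with k ≟ a
... | yes k≡a = at-a k≡a
... | no k≢a with k ≟ b
...   | yes k≡b = at-b k≢a k≡b
...   | no k≢b = other k≢a k≢b

-- Read PC.transpose b a j as the new position of the entry at j after swapping the adjacent
-- positions a and b = a + 1, and PC.transpose a b k as the old position of the entry now at k.
transpose-adjacent-≤ : ∀ {m} (a b : Fin m) → toℕ b ≡ suc (toℕ a) → (j k : Fin m) →
  toℕ k ≤ toℕ (PC.transpose b a j) →
  toℕ (PC.transpose a b k) ≤ toℕ j ⊎ (toℕ a ≤ toℕ j × PC.transpose a b k ≡ b)
transpose-adjacent-≤ a b b≡1+a j k = go (transpose-view b a j) (transpose-view a b k)
  where
  a≤b : toℕ a ≤ toℕ b
  a≤b = subst (toℕ a ≤_) (≡-sym b≡1+a) (n≤1+n _)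
  go : ∀ {j k j′ k′} → TransposeView b a j j′ → TransposeView a b k k′ →
    toℕ k ≤ toℕ j′ → toℕ k′ ≤ toℕ j ⊎ (toℕ a ≤ toℕ j × k′ ≡ b)
  go (at-a refl)   (at-a refl)       _    = inj₁ ≤-refl
  go (at-a refl)   (at-b _ _)        _    = inj₁ a≤b
  go (at-a refl)   (other _ _)       k≤a  = inj₁ (≤-trans k≤a a≤b)
  go (at-b _ refl) (at-a refl)       _    = inj₂ (≤-refl , refl)
  go (at-b _ refl) (at-b _ _)        _    = inj₁ ≤-refl
  go (at-b _ refl) (other _ k≢b)     k≤b  = inj₁ (≤-pred (subst (_ <_) b≡1+a (≤∧≢⇒< k≤b (k≢b ∘ toℕ-injective))))
  go (other _ _)   (at-a refl)       a≤j  = inj₂ (a≤j , refl)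
  go (other _ _)   (at-b _ refl)     b≤j  = inj₁ (≤-trans a≤b b≤j)
  go (other _ _)   (other _ _)       k≤j  = inj₁ k≤j

⟨$⟩ʳ≡⇒⟨$⟩ˡ≡ : ∀ {n} (σ : Permutation′ n) {j x} → σ ⟨$⟩ʳ j ≡ x → σ ⟨$⟩ˡ x ≡ j
⟨$⟩ʳ≡⇒⟨$⟩ˡ≡ σ e = Inverse.inverseʳ σ (≡-sym e)

⟨$⟩ˡ-injective : ∀ {n} (σ : Permutation′ n) {x y} → σ ⟨$⟩ˡ x ≡ σ ⟨$⟩ˡ y → x ≡ y
⟨$⟩ˡ-injective σ e = trans (≡-sym (inverseʳ σ)) (trans (cong (σ ⟨$⟩ʳ_) e) (inverseʳ σ))

ℕ→ℚ : ℕ → ℚ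
ℕ→ℚ m = mkℚ (ℤ.+ m) 0 (coprime-sym (1-coprimeTo m))

ℕ→ℚ-mono-≤ : ∀ {m k} → m ≤ k → ℕ→ℚ m ≤ℚ ℕ→ℚ k
ℕ→ℚ-mono-≤ m≤k = *≤* (ℤ.*-monoʳ-≤-nonNeg (ℤ.+ 1) (ℤ.+≤+ m≤k))

ℕ→ℚ-mono-< : ∀ {m k} → m < k → ℕ→ℚ m <ℚ ℕ→ℚ k
ℕ→ℚ-mono-< m<k = *<* (ℤ.*-monoʳ-<-pos (ℤ.+ 1) (ℤ.+<+ m<k))

ℕ→ℚ-cancel-< : ∀ {m k} → ℕ→ℚ m <ℚ ℕ→ℚ k → m < k
ℕ→ℚ-cancel-< m<k = ℤ.drop‿+<+ (ℤ.*-cancelʳ-<-nonNeg (ℤ.+ 1) (drop-*<* m<k))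

isIntervalOrderGraph-ℕ : ∀ {n} (H : EdgeRel n) (l r : Fin n → ℕ) → (∀ x → l x ≤ r x) →
  (∀ x y → H x y ⇔ (r x < l y ⊎ r y < l x)) → IsIntervalOrderGraph H
isIntervalOrderGraph-ℕ H l r l≤r H⇔ =
  ℕ→ℚ ∘ l , ℕ→ℚ ∘ r , (λ x → ℕ→ℚ-mono-≤ (l≤r x)) ,
  λ x y → ⊎-map ℕ→ℚ-mono-< ℕ→ℚ-mono-< ∘ Equivalence.to (H⇔ x y) ,
          Equivalence.from (H⇔ x y) ∘ ⊎-map ℕ→ℚ-cancel-< ℕ→ℚ-cancel-<

≅E-refl : ∀ {n} {K : EdgeRel n} → K ≅E K
≅E-refl x y = id , id

module _ {n : ℕ} (G : Graph n) where

  AdjUpTo : Ordering n → Fin n → Fin n → Set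
  AdjUpTo σ j y = AllUpTo (λ k → Adj G (σ ⟨$⟩ʳ k) y) j

  -- GSigma G σ x y unfolds to  Arc σ x y ⊎ Arc σ y x.
  Arc : Ordering n → Fin n → Fin n → Set
  Arc σ x y = ∃ λ j → (σ ⟨$⟩ʳ j ≡ x) × AdjUpTo σ j y

  Arc⇒Adj : ∀ σ {x y} → Arc σ x y → Adj G x y
  Arc⇒Adj σ {y = y} (j , σj≡x , h) = subst (λ z → Adj G z y) σj≡x (h j ≤-refl)

  AdjUpTo-agree : ∀ σ σ′ {j y} → (∀ k → toℕ k ≤ toℕ j → σ′ ⟨$⟩ʳ k ≡ σ ⟨$⟩ʳ k) → AdjUpTo σ′ j y → AdjUpTo σ j y
  AdjUpTo-agree σ σ′ {y = y} agree h k k≤j = subst (λ z → Adj G z y) (agree k k≤j) (h k k≤j)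

  firstNonNeighbour : (σ : Ordering n) (y : Fin n) →
    ∃ λ q → ¬ Adj G (σ ⟨$⟩ʳ q) y × (∀ k → toℕ k < toℕ q → Adj G (σ ⟨$⟩ʳ k) y)
  firstNonNeighbour σ y = smallestCounterexample (λ k → adj? G (σ ⟨$⟩ʳ k) y)
    (λ all → irrefl G (subst (λ z → Adj G z y) (inverseʳ σ) (all (σ ⟨$⟩ˡ y))))

  module _ (σ : Ordering n) {q y : Fin n} (¬adj : ¬ Adj G (σ ⟨$⟩ʳ q) y)
           (below : ∀ k → toℕ k < toℕ q → Adj G (σ ⟨$⟩ʳ k) y) where

    firstNonNeighbour≤position : toℕ q ≤ toℕ (σ ⟨$⟩ˡ y)
    firstNonNeighbour≤position = ≮⇒≥ λ y<q → irrefl G (subst (λ z → Adj G z y) (inverseʳ σ) (below _ y<q))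

    Arc⇔position<firstNonNeighbour : ∀ x → Arc σ x y ⇔ toℕ (σ ⟨$⟩ˡ x) < toℕ q
    Arc⇔position<firstNonNeighbour x = mk⇔ to from
      where
      to : Arc σ x y → toℕ (σ ⟨$⟩ˡ x) < toℕ q
      to (j , σj≡x , h) rewrite ⟨$⟩ʳ≡⇒⟨$⟩ˡ≡ σ σj≡x = ≰⇒> λ q≤j → ¬adj (h q q≤j)
      from : toℕ (σ ⟨$⟩ˡ x) < toℕ q → Arc σ x y
      from x<q = σ ⟨$⟩ˡ x , inverseʳ σ , λ k k≤x → below k (≤-<-trans k≤x x<q)

  GSigma-isIntervalOrderGraph : (σ : Ordering n) → IsIntervalOrderGraph (GSigma G σ)
  GSigma-isIntervalOrderGraph σ =
    isIntervalOrderGraph-ℕ (GSigma G σ) left position left≤position λ x y → arc⇔ x y ⊎-⇔ arc⇔ y x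
    where
    position : Fin n → ℕ
    position x = toℕ (σ ⟨$⟩ˡ x)
    left : Fin n → ℕ
    left y = toℕ (proj₁ (firstNonNeighbour σ y))
    left≤position : ∀ y → left y ≤ position y
    left≤position y = let _ , ¬adj , below = firstNonNeighbour σ y in firstNonNeighbour≤position σ ¬adj below
    arc⇔ : ∀ x y → Arc σ x y ⇔ position x < left y
    arc⇔ x y = let _ , ¬adj , below = firstNonNeighbour σ y in Arc⇔position<firstNonNeighbour σ ¬adj below x

  GSigma⊆Adj : (σ : Ordering n) → GSigma G σ ⊆E Adj G
  GSigma⊆Adj σ x y = [ Arc⇒Adj σ , Graph.sym G ∘ Arc⇒Adj σ ]′

  Arc⊆⇒GSigma⊆ : ∀ σ σ′ → (∀ {x y} → Arc σ x y → Arc σ′ x y) → GSigma G σ ⊆E GSigma G σ′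
  Arc⊆⇒GSigma⊆ σ σ′ f x y = ⊎-map f f

  maximal⇒GSigma-≅E : ∀ {H} σ σ′ → IsIntervalOrderSubgraph G H →
    GSigma G σ ≅E H → GSigma G σ ⊆E GSigma G σ′ → GSigma G σ′ ≅E H
  maximal⇒GSigma-≅E σ σ′ (_ , _ , maximal) σ≅H σ⊆σ′ x y =
    maximal (GSigma G σ′) (GSigma-isIntervalOrderGraph σ′) (GSigma⊆Adj σ′) (λ a b → σ⊆σ′ a b ∘ proj₂ (σ≅H a b)) x y ,
    σ⊆σ′ x y ∘ proj₂ (σ≅H x y)

  Arc-transposeAdjacent : (σ : Ordering n) (a b : Fin n) → toℕ b ≡ suc (toℕ a) →
    (∀ y → AdjUpTo σ a y → Adj G (σ ⟨$⟩ʳ b) y) →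
    ∀ {x y} → Arc σ x y → Arc (transpose a b ∘ₚ σ) x y
  Arc-transposeAdjacent σ a b b≡1+a b-covers {y = y} (j , σj≡x , h) =
    PC.transpose b a j , trans (cong (σ ⟨$⟩ʳ_) (PC.transpose-inverse a b)) σj≡x , adjUpTo
    where
    adjUpTo : ∀ k → toℕ k ≤ toℕ (PC.transpose b a j) → Adj G (σ ⟨$⟩ʳ PC.transpose a b k) y
    adjUpTo k k≤j′ with transpose-adjacent-≤ a b b≡1+a j k k≤j′
    ... | inj₁ k′≤j = h _ k′≤j
    ... | inj₂ (a≤j , k′≡b) = subst (λ z → Adj G (σ ⟨$⟩ʳ z) y) (≡-sym k′≡b) (b-covers y (AllUpTo-≤ a≤j h))

  MovedForward : Ordering n → Fin n → Fin n → Ordering n → Set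
  MovedForward σ q u σ′ =
    (σ′ ⟨$⟩ʳ q ≡ u) × (∀ k → toℕ k < toℕ q → σ′ ⟨$⟩ʳ k ≡ σ ⟨$⟩ʳ k) × (GSigma G σ ⊆E GSigma G σ′)

  MovedForward-step : ∀ {σ σ₁ u} (q q′ : Fin n) → toℕ q′ ≡ suc (toℕ q) →
    (∀ y → AdjUpTo σ q y → Adj G u y) → MovedForward σ q′ u σ₁ → MovedForward σ q u (transpose q q′ ∘ₚ σ₁)
  MovedForward-step {σ} {σ₁} {u} q q′ q′≡1+q covers (σ₁q′≡u , agree , σ⊆σ₁) =
    trans (cong (σ₁ ⟨$⟩ʳ_) (transpose-≡ˡ q q′)) σ₁q′≡u , agree′ ,
    λ x y → Arc⊆⇒GSigma⊆ σ₁ (transpose q q′ ∘ₚ σ₁) (Arc-transposeAdjacent σ₁ q q′ q′≡1+q q′-covers) x y ∘ σ⊆σ₁ x y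
    where
    ≤q⇒<q′ : ∀ {k} → toℕ k ≤ toℕ q → toℕ k < toℕ q′
    ≤q⇒<q′ k≤q = subst (_ <_) (≡-sym q′≡1+q) (s≤s k≤q)
    agree′ : ∀ k → toℕ k < toℕ q → σ₁ ⟨$⟩ʳ PC.transpose q q′ k ≡ σ ⟨$⟩ʳ k
    agree′ k k<q = trans (cong (σ₁ ⟨$⟩ʳ_) (transpose-≢ (<⇒≢ k<q ∘ cong toℕ) (<⇒≢ (≤q⇒<q′ (<⇒≤ k<q)) ∘ cong toℕ)))
                         (agree k (≤q⇒<q′ (<⇒≤ k<q)))
    q′-covers : ∀ y → AdjUpTo σ₁ q y → Adj G (σ₁ ⟨$⟩ʳ q′) y
    q′-covers y h = subst (λ z → Adj G z y) (≡-sym σ₁q′≡u) (covers y (AdjUpTo-agree σ σ₁ (λ k → agree k ∘ ≤q⇒<q′) h))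

  -- u is first brought to q + 1, so that the final swap at q only uses the hypothesis for σ.
  moveForward : (σ : Ordering n) (q u : Fin n) → toℕ q ≤ toℕ (σ ⟨$⟩ˡ u) →
    (∀ y → AdjUpTo σ q y → Adj G u y) → ∃ (MovedForward σ q u)
  moveForward σ q u q≤u = go _ q (≡-sym (m+[n∸m]≡n q≤u))
    where
    go : ∀ d q → toℕ (σ ⟨$⟩ˡ u) ≡ toℕ q + d → (∀ y → AdjUpTo σ q y → Adj G u y) → ∃ (MovedForward σ q u)
    go zero q u≡q _ =
      σ , trans (cong (σ ⟨$⟩ʳ_) (toℕ-injective (≡-sym (trans u≡q (+-identityʳ _))))) (inverseʳ σ) ,
      (λ _ _ → refl) , (λ _ _ → id)
    go (suc d) q u≡q+1+d covers =
      let σ₁ , moved = go d q′ u≡q′+d (λ y → covers y ∘ AllUpTo-≤ (<⇒≤ q<q′))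
      in transpose q q′ ∘ₚ σ₁ , MovedForward-step {σ} {σ₁} q q′ q′≡1+q covers moved
      where
      q+1≤u : suc (toℕ q) ≤ toℕ (σ ⟨$⟩ˡ u)
      q+1≤u = subst (suc (toℕ q) ≤_) (≡-sym (trans u≡q+1+d (+-suc _ d))) (m≤m+n (suc (toℕ q)) d)
      q+1<n : suc (toℕ q) < n
      q+1<n = ≤-<-trans q+1≤u (toℕ<n (σ ⟨$⟩ˡ u))
      q′ : Fin n
      q′ = fromℕ< q+1<n
      q′≡1+q : toℕ q′ ≡ suc (toℕ q)
      q′≡1+q = toℕ-fromℕ< q+1<n
      q<q′ : toℕ q < toℕ q′
      q<q′ = subst (toℕ q <_) (≡-sym q′≡1+q) ≤-refl
      u≡q′+d : toℕ (σ ⟨$⟩ˡ u) ≡ toℕ q′ + d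
      u≡q′+d = trans u≡q+1+d (trans (+-suc _ d) (cong (_+ d) (≡-sym q′≡1+q)))

  MovedForward⇒Precedes : ∀ σ σ′ {q u v} → MovedForward σ q u σ′ → u ≢ v → toℕ q ≤ toℕ (σ ⟨$⟩ˡ v) → Precedes σ′ u v
  MovedForward⇒Precedes σ σ′ {q} {v = v} (σ′q≡u , agree , _) u≢v q≤v rewrite ⟨$⟩ʳ≡⇒⟨$⟩ˡ≡ σ′ σ′q≡u = ≤∧≢⇒< q≤v′ q≢v′
    where
    q≤v′ : toℕ q ≤ toℕ (σ′ ⟨$⟩ˡ v)
    q≤v′ = ≮⇒≥ λ v′<q → <⇒≢ (<-≤-trans v′<q q≤v)
      (cong toℕ (≡-sym (⟨$⟩ʳ≡⇒⟨$⟩ˡ≡ σ (trans (≡-sym (agree _ v′<q)) (inverseʳ σ′)))))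
    q≢v′ : toℕ q ≢ toℕ (σ′ ⟨$⟩ˡ v)
    q≢v′ q≡v′ = u≢v (trans (≡-sym σ′q≡u) (trans (cong (σ′ ⟨$⟩ʳ_) (toℕ-injective q≡v′)) (inverseʳ σ′)))

  moveForward⇒edge : ∀ {H} σ → IsIntervalOrderSubgraph G H → GSigma G σ ≅E H → (q x y : Fin n) →
    toℕ q ≤ toℕ (σ ⟨$⟩ˡ x) → (∀ z → AdjUpTo σ q z → Adj G x z) →
    (∀ k → toℕ k < toℕ q → Adj G (σ ⟨$⟩ʳ k) y) → Adj G x y → GSigma G σ x y
  moveForward⇒edge σ maximal σ≅H q x y q≤x covers below xy with moveForward σ q x q≤x covers
  ... | σ′ , σ′q≡x , agree , σ⊆σ′ =
    proj₂ (σ≅H x y) (proj₁ (maximal⇒GSigma-≅E σ σ′ maximal σ≅H σ⊆σ′ x y) (inj₁ (q , σ′q≡x , adjUpTo)))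
    where
    adjUpTo : AdjUpTo σ′ q y
    adjUpTo k k≤q with k ≟ q
    ... | yes refl = subst (λ z → Adj G z y) (≡-sym σ′q≡x) xy
    ... | no k≢q = subst (λ z → Adj G z y) (≡-sym (agree k k<q)) (below k k<q)
      where k<q = ≤∧≢⇒< k≤q (k≢q ∘ toℕ-injective)

  module _ {i : ℕ} (τ : Fin i → Fin n) where

    InPrefix? : Decidable (InPrefix τ)
    InPrefix? x = any? λ k → τ k ≟ x

    NPlus? : Decidable (NPlus G τ)
    NPlus? y = all? λ k → adj? G (τ k) y

    InNi? : Decidable (InNi G τ)
    InNi? x = ¬? (InPrefix? x) ×-dec all? λ z → NPlus? z →-dec adj? G x z

    NPlus⇒¬InPrefix : ∀ {y} → NPlus G τ y → ¬ InPrefix τ y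
    NPlus⇒¬InPrefix {y} ny (k , τk≡y) = irrefl G (subst (λ z → Adj G z y) τk≡y (ny k))

    module _ (σ : Ordering n) (hp : HasPrefix σ τ) where

      prefix-at : ∀ j (j<i : toℕ j < i) → σ ⟨$⟩ʳ j ≡ τ (fromℕ< j<i)
      prefix-at j j<i with hp (fromℕ< j<i)
      ... | j′ , j′≡ , σj′≡τ = trans (cong (σ ⟨$⟩ʳ_) (toℕ-injective (≡-sym (trans j′≡ (toℕ-fromℕ< j<i))))) σj′≡τ

      prefix-position : ∀ {j k} → σ ⟨$⟩ʳ j ≡ τ k → toℕ j ≡ toℕ k
      prefix-position {j} {k} σj≡τk with hp k
      ... | j′ , j′≡k , σj′≡τk = trans (cong toℕ (trans (≡-sym (⟨$⟩ʳ≡⇒⟨$⟩ˡ≡ σ (trans σj≡τk (≡-sym σj′≡τk)))) (inverseˡ σ))) j′≡k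

      outsidePrefix⇒i≤ : ∀ {j x} → ¬ InPrefix τ x → σ ⟨$⟩ʳ j ≡ x → i ≤ toℕ j
      outsidePrefix⇒i≤ {j} ¬px σj≡x = ≮⇒≥ λ j<i → ¬px (fromℕ< j<i , trans (≡-sym (prefix-at j j<i)) σj≡x)

      AdjUpTo⇒NPlus : ∀ {j y} → i ≤ toℕ j → AdjUpTo σ j y → NPlus G τ y
      AdjUpTo⇒NPlus {j} {y} i≤j h k with hp k
      ... | j′ , j′≡k , σj′≡τk =
        subst (λ z → Adj G z y) σj′≡τk (h j′ (subst (_≤ toℕ j) (≡-sym j′≡k) (<⇒≤ (<-≤-trans (toℕ<n k) i≤j))))

      NPlus⇒adjacentBelow : ∀ {y k} → NPlus G τ y → toℕ k < i → Adj G (σ ⟨$⟩ʳ k) y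
      NPlus⇒adjacentBelow {y} {k} ny k<i = subst (λ z → Adj G z y) (≡-sym (prefix-at k k<i)) (ny _)

      HasPrefix-agree : ∀ {σ′ : Ordering n} {q : Fin n} → i ≤ toℕ q → (∀ k → toℕ k < toℕ q → σ′ ⟨$⟩ʳ k ≡ σ ⟨$⟩ʳ k) → HasPrefix σ′ τ
      HasPrefix-agree i≤q agree k with hp k
      ... | j , j≡k , σj≡τk = j , j≡k , trans (agree j (<-≤-trans (subst (_< i) (≡-sym j≡k) (toℕ<n k)) i≤q)) σj≡τk

    InNi⇒GSigma-NPlus : ∀ {H} σ → IsIntervalOrderSubgraph G H → HasPrefix σ τ → GSigma G σ ≅E H →
      ∀ {w y} → InNi G τ w → NPlus G τ y → GSigma G σ w y
    InNi⇒GSigma-NPlus σ maximal hp σ≅H {w} {y} (¬pw , w-covers) ny =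
      moveForward⇒edge σ maximal σ≅H q w y (subst (_≤ _) (≡-sym q≡i) i≤w) covers below (w-covers y ny)
      where
      i≤w : i ≤ toℕ (σ ⟨$⟩ˡ w)
      i≤w = outsidePrefix⇒i≤ σ hp ¬pw (inverseʳ σ)
      i<n : i < n
      i<n = ≤-<-trans i≤w (toℕ<n _)
      q : Fin n
      q = fromℕ< i<n
      q≡i : toℕ q ≡ i
      q≡i = toℕ-fromℕ< i<n
      covers : ∀ z → AdjUpTo σ q z → Adj G w z
      covers z h = w-covers z (AdjUpTo⇒NPlus σ hp (subst (i ≤_) (≡-sym q≡i) ≤-refl) h)
      below : ∀ k → toℕ k < toℕ q → Adj G (σ ⟨$⟩ʳ k) y
      below k k<q = NPlus⇒adjacentBelow σ hp ny (subst (toℕ k <_) q≡i k<q)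

    precedence-attainable : ∀ {H} σ → IsIntervalOrderSubgraph G H → HasPrefix σ τ → GSigma G σ ≅E H →
      (u v : Fin n) → u ≢ v → ¬ InPrefix τ v →
      (∀ x → Adj G v x → NPlus G τ x → Adj G u x) →
      ∃ λ σ′ → HasPrefix σ′ τ × (GSigma G σ′ ≅E H) × Precedes σ′ u v
    precedence-attainable σ maximal hp σ≅H u v u≢v ¬pv dominates
      with <-cmp (toℕ (σ ⟨$⟩ˡ u)) (toℕ (σ ⟨$⟩ˡ v))
    ... | tri< u<v _ _ = σ , hp , σ≅H , u<v
    ... | tri≈ _ u≡v _ = ⊥-elim (u≢v (⟨$⟩ˡ-injective σ (toℕ-injective u≡v)))
    ... | tri> _ _ v<u with moveForward σ q u (<⇒≤ v<u) covers
      where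
      q : Fin n
      q = σ ⟨$⟩ˡ v
      covers : ∀ y → AdjUpTo σ q y → Adj G u y
      covers y h = dominates y (subst (λ z → Adj G z y) (inverseʳ σ) (h q ≤-refl))
                     (AdjUpTo⇒NPlus σ hp (outsidePrefix⇒i≤ σ hp ¬pv (inverseʳ σ)) h)
    ...   | σ′ , moved@(_ , agree , σ⊆σ′) =
      σ′ , HasPrefix-agree σ hp {σ′} (outsidePrefix⇒i≤ σ hp ¬pv (inverseʳ σ)) agree ,
      maximal⇒GSigma-≅E σ σ′ maximal σ≅H σ⊆σ′ , MovedForward⇒Precedes σ σ′ moved u≢v ≤-refl

    InNi-precedes : ∀ {H} σ → IsIntervalOrderSubgraph G H → HasPrefix σ τ → GSigma G σ ≅E H →
      (w x : Fin n) → InNi G τ w → ¬ InPrefix τ x → ¬ InNi G τ x → Precedes σ w x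
    InNi-precedes σ maximal hp σ≅H w x niw ¬px ¬nix = ≤∧≢⇒< w≤x w≢x
      where
      w≢x : toℕ (σ ⟨$⟩ˡ w) ≢ toℕ (σ ⟨$⟩ˡ x)
      w≢x w≡x = ¬nix (subst (InNi G τ) (⟨$⟩ˡ-injective σ (toℕ-injective w≡x)) niw)
      x-covers : toℕ (σ ⟨$⟩ˡ x) < toℕ (σ ⟨$⟩ˡ w) → ∀ y → NPlus G τ y → Adj G x y
      x-covers x<w y ny = [ viaArcFromW , viaArcToW ]′ (InNi⇒GSigma-NPlus σ maximal hp σ≅H niw ny)
        where
        viaArcFromW : Arc σ w y → Adj G x y
        viaArcFromW (j , σj≡w , h) =
          subst (λ z → Adj G z y) (inverseʳ σ)
            (h (σ ⟨$⟩ˡ x) (subst (λ j → toℕ (σ ⟨$⟩ˡ x) ≤ toℕ j) (⟨$⟩ʳ≡⇒⟨$⟩ˡ≡ σ σj≡w) (<⇒≤ x<w)))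
        viaArcToW : Arc σ y w → Adj G x y
        viaArcToW (j , σj≡y , h) =
          ⊥-elim (irrefl G (proj₂ niw w (AdjUpTo⇒NPlus σ hp (outsidePrefix⇒i≤ σ hp (NPlus⇒¬InPrefix ny) σj≡y) h)))
      w≤x : toℕ (σ ⟨$⟩ˡ w) ≤ toℕ (σ ⟨$⟩ˡ x)
      w≤x = ≮⇒≥ λ x<w → ¬nix (¬px , x-covers x<w)

    PrefixArc : Fin n → Fin n → Set
    PrefixArc x y = ∃ λ k → (τ k ≡ x) × AllUpTo (λ k′ → Adj G (τ k′) y) k

    Arc⇒PrefixArc : ∀ σ → HasPrefix σ τ → ∀ {x y} → InPrefix τ x → Arc σ x y → PrefixArc x y
    Arc⇒PrefixArc σ hp {y = y} (k , τk≡x) (j , σj≡x , h) = k , τk≡x , adj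
      where
      adj : ∀ k′ → toℕ k′ ≤ toℕ k → Adj G (τ k′) y
      adj k′ k′≤k with hp k′
      ... | j′ , j′≡k′ , σj′≡τk′ =
        subst (λ z → Adj G z y) σj′≡τk′
          (h j′ (subst₂ _≤_ (≡-sym j′≡k′) (≡-sym (prefix-position σ hp (trans σj≡x (≡-sym τk≡x)))) k′≤k))

    PrefixArc⇒Arc : ∀ σ → HasPrefix σ τ → ∀ {x y} → PrefixArc x y → Arc σ x y
    PrefixArc⇒Arc σ hp {y = y} (k , τk≡x , h) with hp k
    ... | j , j≡k , σj≡τk = j , trans σj≡τk τk≡x , adj
      where
      adj : AdjUpTo σ j y
      adj k′ k′≤j = subst (λ z → Adj G z y) (≡-sym (prefix-at σ hp k′ k′<i))
                      (h _ (subst₂ _≤_ (≡-sym (toℕ-fromℕ< k′<i)) j≡k k′≤j))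
        where
        k′<i : toℕ k′ < i
        k′<i = ≤-<-trans k′≤j (subst (_< i) (≡-sym j≡k) (toℕ<n k))

    Outlier : Fin n → Set
    Outlier x = ¬ InPrefix τ x × ¬ InNi G τ x

    Outlier? : Decidable Outlier
    Outlier? x = ¬? (InPrefix? x) ×-dec ¬? (InNi? x)

    FirstOutlier : Ordering n → Fin n → Set
    FirstOutlier σ q = Outlier (σ ⟨$⟩ʳ q) × (∀ k → toℕ k < toℕ q → ¬ Outlier (σ ⟨$⟩ʳ k))

    FirstOutlierMisses : Ordering n → Fin n → Set
    FirstOutlierMisses σ c′ = (∀ j → ¬ Outlier (σ ⟨$⟩ʳ j)) ⊎ ∃ λ q → FirstOutlier σ q × ¬ Adj G (σ ⟨$⟩ʳ q) c′

    ForcedArc : Fin n → Fin n → Fin n → Set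
    ForcedArc c x y = PrefixArc x y ⊎ (InNi G τ x × NPlus G τ y) ⊎ (Outlier x × Adj G x c × y ≡ c)

    Forced : Fin n → EdgeRel n
    Forced c x y = ForcedArc c x y ⊎ ForcedArc c y x

    module _ (c c′ : Fin n) (N⁺⊆ : ∀ z → NPlus G τ z → z ≡ c ⊎ z ≡ c′) (nc : NPlus G τ c)
             (σ : Ordering n) (hp : HasPrefix σ τ) (maximal : IsIntervalOrderSubgraph G (GSigma G σ)) where

      outlierArc⇒≡c : FirstOutlierMisses σ c′ → ∀ {x y} → Outlier x → Arc σ x y → y ≡ c
      outlierArc⇒≡c (inj₁ none) out (j , σj≡x , _) = ⊥-elim (none j (subst Outlier (≡-sym σj≡x) out))
      outlierArc⇒≡c (inj₂ (q , (_ , first) , ¬adj)) {y = y} out (j , σj≡x , h)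
        with N⁺⊆ y (AdjUpTo⇒NPlus σ hp (outsidePrefix⇒i≤ σ hp (proj₁ out) σj≡x) h)
      ... | inj₁ y≡c = y≡c
      ... | inj₂ refl = ⊥-elim (¬adj (h q (≮⇒≥ λ j<q → first j j<q (subst Outlier (≡-sym σj≡x) out))))

      Arc⇒ForcedArc : FirstOutlierMisses σ c′ → ∀ {x y} → Arc σ x y → ForcedArc c x y
      Arc⇒ForcedArc outliers {x} arc@(j , σj≡x , h) with InPrefix? x | InNi? x
      ... | yes px | _ = inj₁ (Arc⇒PrefixArc σ hp px arc)
      ... | no ¬px | yes nix = inj₂ (inj₁ (nix , AdjUpTo⇒NPlus σ hp (outsidePrefix⇒i≤ σ hp ¬px σj≡x) h))
      ... | no ¬px | no ¬nix =
        inj₂ (inj₂ ((¬px , ¬nix) , subst (Adj G x) y≡c (Arc⇒Adj σ arc) , y≡c))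
        where y≡c = outlierArc⇒≡c outliers (¬px , ¬nix) arc

      -- An outlier x adjacent to c can be moved into the place of the first outlier.
      outlier⇒GSigma : FirstOutlierMisses σ c′ → ∀ {x} → Outlier x → Adj G x c → GSigma G σ x c
      outlier⇒GSigma (inj₁ none) {x} out xc = ⊥-elim (none (σ ⟨$⟩ˡ x) (subst Outlier (≡-sym (inverseʳ σ)) out))
      outlier⇒GSigma (inj₂ (q , (outq , first) , ¬adj)) {x} out xc =
        moveForward⇒edge σ maximal ≅E-refl q x c q≤x covers below xc
        where
        q≤x : toℕ q ≤ toℕ (σ ⟨$⟩ˡ x)
        q≤x = ≮⇒≥ λ x<q → first _ x<q (subst Outlier (≡-sym (inverseʳ σ)) out)
        covers : ∀ z → AdjUpTo σ q z → Adj G x z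
        covers z h with N⁺⊆ z (AdjUpTo⇒NPlus σ hp (outsidePrefix⇒i≤ σ hp (proj₁ outq) refl) h)
        ... | inj₁ refl = xc
        ... | inj₂ refl = ⊥-elim (¬adj (h q ≤-refl))
        below : ∀ k → toℕ k < toℕ q → Adj G (σ ⟨$⟩ʳ k) c
        below k k<q = decidable-stable (adj? G _ c) λ ¬kc →
          first k k<q ((λ (k′ , τk′≡) → ¬kc (subst (λ z → Adj G z c) τk′≡ (nc k′))) , λ nik → ¬kc (proj₂ nik c nc))

      ForcedArc⇒GSigma : FirstOutlierMisses σ c′ → ∀ {x y} → ForcedArc c x y → GSigma G σ x y
      ForcedArc⇒GSigma _ (inj₁ parc) = inj₁ (PrefixArc⇒Arc σ hp parc)
      ForcedArc⇒GSigma _ (inj₂ (inj₁ (nix , ny))) = InNi⇒GSigma-NPlus σ maximal hp ≅E-refl nix ny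
      ForcedArc⇒GSigma outliers (inj₂ (inj₂ (out , xc , refl))) = outlier⇒GSigma outliers out xc

      GSigma≅Forced : FirstOutlierMisses σ c′ → GSigma G σ ≅E Forced c
      GSigma≅Forced outliers x y =
        ⊎-map (Arc⇒ForcedArc outliers) (Arc⇒ForcedArc outliers) ,
        [ ForcedArc⇒GSigma outliers , ⊎-swap ∘ ForcedArc⇒GSigma outliers ]′

    firstOutlier-misses : (a b : Fin n) → (∀ z → NPlus G τ z → z ≡ a ⊎ z ≡ b) → (σ : Ordering n) →
      FirstOutlierMisses σ b ⊎ FirstOutlierMisses σ a
    firstOutlier-misses a b N⁺⊆ σ with none⊎first (Outlier? ∘ (σ ⟨$⟩ʳ_))
    ... | inj₁ none = inj₁ (inj₁ none)
    ... | inj₂ (q , first@((¬pq , ¬niq) , _)) with adj? G (σ ⟨$⟩ʳ q) b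
    ...   | no ¬qb = inj₁ (inj₂ (q , first , ¬qb))
    ...   | yes qb = inj₂ (inj₂ (q , first , λ qa → ¬niq (¬pq , λ z nz →
            [ (λ z≡a → subst (Adj G _) (≡-sym z≡a) qa) , (λ z≡b → subst (Adj G _) (≡-sym z≡b) qb) ]′ (N⁺⊆ z nz))))

    GSigma≅Forced-either : (a b : Fin n) →
      (∀ w → (NPlus G τ w → w ≡ a ⊎ w ≡ b) × (w ≡ a ⊎ w ≡ b → NPlus G τ w)) →
      (σ : Ordering n) → HasPrefix σ τ → IsIntervalOrderSubgraph G (GSigma G σ) →
      (GSigma G σ ≅E Forced a) ⊎ (GSigma G σ ≅E Forced b)
    GSigma≅Forced-either a b N⁺≡ σ hp maximal =
      ⊎-map (GSigma≅Forced a b N⁺⊆ (proj₂ (N⁺≡ a) (inj₁ refl)) σ hp maximal)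
            (GSigma≅Forced b a (λ z → ⊎-swap ∘ N⁺⊆ z) (proj₂ (N⁺≡ b) (inj₂ refl)) σ hp maximal)
            (firstOutlier-misses a b N⁺⊆ σ)
      where
      N⁺⊆ : ∀ z → NPlus G τ z → z ≡ a ⊎ z ≡ b
      N⁺⊆ z = proj₁ (N⁺≡ z)

lemma4 : (n : ℕ) (G : Graph n) (i : ℕ) (τ : Fin i → Fin n) →
    Injective _≡_ _≡_ τ → 1 ≤ i →
    (H : EdgeRel n) → IsIntervalOrderSubgraph G H →
    (∃ λ (σ : Ordering n) → HasPrefix σ τ × (GSigma G σ ≅E H)) →
    -- (i)
    ((u v : Fin n) → u ≢ v → ¬ InPrefix τ u → ¬ InPrefix τ v →
      (∀ (x : Fin n) → Adj G v x → NPlus G τ x → Adj G u x) →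
      ∃ λ (σ : Ordering n) → HasPrefix σ τ × (GSigma G σ ≅E H) × Precedes σ u v)
    ×
    -- (ii)
    ((σ : Ordering n) → HasPrefix σ τ → (GSigma G σ ≅E H) →
      (w x : Fin n) → InNi G τ w → ¬ InPrefix τ x → ¬ InNi G τ x → Precedes σ w x)
    ×
    -- (iii)
    ((Σ (Fin n) λ a → Σ (Fin n) λ b → (a ≢ b) ×
        (∀ (w : Fin n) → (NPlus G τ w → (w ≡ a ⊎ w ≡ b)) × ((w ≡ a ⊎ w ≡ b) → NPlus G τ w))) →
      Σ (EdgeRel n) λ H₁ → Σ (EdgeRel n) λ H₂ →
        ((σ : Ordering n) → HasPrefix σ τ → IsIntervalOrderSubgraph G (GSigma G σ) →
          (GSigma G σ ≅E H₁) ⊎ (GSigma G σ ≅E H₂)))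
lemma4 n G i τ _ _ H maximal (σ , hp , σ≅H) =
  (λ u v u≢v _ → precedence-attainable G τ σ maximal hp σ≅H u v u≢v) ,
  (λ σ′ hp′ σ′≅H → InNi-precedes G τ σ′ maximal hp′ σ′≅H) ,
  λ (a , b , _ , N⁺≡) → Forced G τ a , Forced G τ b , GSigma≅Forced-either G τ a b N⁺≡
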